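{- Let $k\in\mathbb{N}$, let $m,n$ be positive integers, and let $P$ be a $k$-solvable distribution on $\Lambda_{m,n}$ such that there is a vertex $x$ with $P(x)\geq k+1$. Define $\hat P$ by $\hat P(x)=P(x)-k$, $\hat P(z)=P(z)+1$ for every neighbour $z$ of $x$, and $\hat P(z)=P(z)$ for every $z$ with $d(x,z)\geq 2$. Then $\hat P$ is also a $k$-solvable distribution on $\Lambda_{m,n}$.
   Context: The grid $\Lambda_{m,n}$ is the graph whose vertices are the $nm$ cells of an $m\times n$ array, two cells being adjacent iff they share a side; $d$ is the graph distance. A pebbling distribution is a function $P:V\to\mathbb{Z}_{\ge0}$. A $k$-pebbling move removes $k$ pebbles from a vertex and adds $1$ pebble to a neighbouring vertex. A vertex $y$ is reachable (from $P$) if there is a sequence of $k$-pebbling moves starting at $P$ and ending in a distribution $Q$ with $Q(y)\ge1$. $P$ is $k$-solvable if every vertex is reachable. -}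

module Defs where

open import Data.Nat using (ℕ; zero; suc; _+_; _∸_; _≤_; _≥_)
open import Data.Fin using (Fin; toℕ)
open import Data.Product using (_×_; _,_; proj₁; proj₂; ∃)
open import Data.Sum using (_⊎_)
open import Relation.Binary.PropositionalEquality using (_≡_; _≢_)
open import Relation.Nullary using (Dec; yes; no; does)
open import Data.Bool using (Bool; if_then_else_)
open import Data.Fin.Properties using () renaming (_≟_ to _≟ᶠ_)
import Data.Nat.Properties as ℕP
open import Data.Product.Properties using (≡-dec)
open import Relation.Nullary.Decidable using (_×-dec_; _⊎-dec_)

-- Vertices of the grid Λ_{m,n}: cells (i , j) of an m × n array.
Cell : ℕ → ℕ → Set
Cell m n = Fin m × Fin n

Adj1 : ℕ → ℕ → Set
Adj1 a b = (suc a ≡ b) ⊎ (suc b ≡ a)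

adj1? : (a b : ℕ) → Dec (Adj1 a b)
adj1? a b = (suc a ℕP.≟ b) ⊎-dec (suc b ℕP.≟ a)

Adjacent : ∀ {m n} → Cell m n → Cell m n → Set
Adjacent (i , j) (i' , j') =
  (i ≡ i' × Adj1 (toℕ j) (toℕ j')) ⊎ (j ≡ j' × Adj1 (toℕ i) (toℕ i'))

adjacent? : ∀ {m n} (c c' : Cell m n) → Dec (Adjacent c c')
adjacent? (i , j) (i' , j') =
  ((i ≟ᶠ i') ×-dec adj1? (toℕ j) (toℕ j')) ⊎-dec ((j ≟ᶠ j') ×-dec adj1? (toℕ i) (toℕ i'))

cell? : ∀ {m n} (c c' : Cell m n) → Dec (c ≡ c')
cell? = ≡-dec _≟ᶠ_ _≟ᶠ_

Distribution : ℕ → ℕ → Set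
Distribution m n = Cell m n → ℕ

data Move {m n : ℕ} (k : ℕ) (P : Distribution m n) : Distribution m n → Set where
  move : (u v : Cell m n) → Adjacent u v → k ≤ P u →
         Move k P (λ z → (if does (cell? z u) then P z ∸ k else P z)
                         + (if does (cell? z v) then 1 else 0))

data Reaches {m n : ℕ} (k : ℕ) : Distribution m n → Distribution m n → Set where
  done : ∀ {P} → Reaches k P P
  step : ∀ {P Q R} → Move k P Q → Reaches k Q R → Reaches k P R

Reachable : ∀ {m n} (k : ℕ) → Distribution m n → Cell m n → Set
Reachable k P y = ∃ λ Q → Reaches k P Q × 1 ≤ Q y

Solvable : ∀ {m n} (k : ℕ) → Distribution m n → Set
Solvable {m} {n} k P = (y : Cell m n) → Reachable k P y

fire : ∀ {m n} (k : ℕ) → Distribution m n → Cell m n → Distribution m n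
fire k P x z =
  if does (cell? z x) then P z ∸ k
  else (if does (adjacent? x z) then suc (P z) else P z)

{-# OPTIONS --safe #-}
-- Replay a sequence of moves from P on P̂, keeping P̂'s side pointwise above
-- "fire x" applied to P's side.  A move out of u ≠ x commutes with firing x
-- up to ≤, so it can be copied.  The first move out of x sends a single
-- pebble to a single neighbour, which firing has already paid for: it is
-- dropped, and from then on P̂'s side dominates P's outright.  So every
-- vertex other than x gets at least as many pebbles from P̂ as from P, and x
-- itself already holds P x ∸ k ≥ 1 pebbles in P̂.
module Submission where

open import Defs
open import Data.Nat using (ℕ; suc; _+_; _≥_; _≤_; _∸_)
open import Data.Nat.Properties
open import Data.Bool using (if_then_else_)
open import Data.Product using (∃; _×_; _,_)
open import Data.Sum using (inj₁; inj₂)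
open import Relation.Nullary using (¬_; Dec; yes; no; does)
open import Relation.Nullary.Decidable using (dec-true; dec-false; toSum)
open import Relation.Binary.PropositionalEquality
  using (_≡_; refl; sym; trans; cong; subst; module ≡-Reasoning)

m+n∸o≤m∸o+n : ∀ m n o → m + n ∸ o ≤ m ∸ o + n
m+n∸o≤m∸o+n m n o = m≤n+o⇒m∸n≤o (m + n) o (begin
  m + n           ≤⟨ +-monoˡ-≤ n (m≤n+m∸n m o) ⟩
  o + (m ∸ o) + n ≡⟨ +-assoc o (m ∸ o) n ⟩
  o + (m ∸ o + n) ∎)
  where open ≤-Reasoning

if-yes : ∀ {A B : Set} (d : Dec A) {a b : B} → A → (if does d then a else b) ≡ a
if-yes d p = cong (if_then _ else _) (dec-true d p)

if-no : ∀ {A B : Set} (d : Dec A) {a b : B} → ¬ A → (if does d then a else b) ≡ b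
if-no d ¬p = cong (if_then _ else _) (dec-false d ¬p)

adjacent-irrefl : ∀ {m n} (x : Cell m n) → ¬ Adjacent x x
adjacent-irrefl _ (inj₁ (_ , inj₁ p)) = 1+n≢n p
adjacent-irrefl _ (inj₁ (_ , inj₂ p)) = 1+n≢n p
adjacent-irrefl _ (inj₂ (_ , inj₁ p)) = 1+n≢n p
adjacent-irrefl _ (inj₂ (_ , inj₂ p)) = 1+n≢n p

adjacent⇒≢ : ∀ {m n} {x z : Cell m n} → Adjacent x z → ¬ z ≡ x
adjacent⇒≢ {x = x} x~x refl = adjacent-irrefl x x~x

module _ {m n : ℕ} (k : ℕ) where

  infix 4 _≼_

  _≼_ : Distribution m n → Distribution m n → Set
  Q ≼ Q' = ∀ z → Q z ≤ Q' z

  ≼-trans : ∀ {Q Q' Q''} → Q ≼ Q' → Q' ≼ Q'' → Q ≼ Q''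
  ≼-trans p q z = ≤-trans (p z) (q z)

  gain : Cell m n → Cell m n → ℕ
  gain v z = if does (cell? z v) then 1 else 0

  -- Definitionally the target of `move u v …` in Move.
  after : Distribution m n → Cell m n → Cell m n → Distribution m n
  after Q u v z = (if does (cell? z u) then Q z ∸ k else Q z) + gain v z

  gain-target : ∀ v → gain v v ≡ 1
  gain-target v = if-yes (cell? v v) refl

  gain-other : ∀ {v z} → ¬ z ≡ v → gain v z ≡ 0
  gain-other {v} {z} z≢v = if-no (cell? z v) z≢v

  after-source : ∀ (Q : Distribution m n) u v → after Q u v u ≡ Q u ∸ k + gain v u
  after-source Q u v = cong (_+ gain v u) (if-yes (cell? u u) refl)

  after-other : ∀ (Q : Distribution m n) {u} v {z} → ¬ z ≡ u → after Q u v z ≡ Q z + gain v z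
  after-other Q {u} v {z} z≢u = cong (_+ gain v z) (if-no (cell? z u) z≢u)

  after-mono : ∀ {Q Q'} u v → Q ≼ Q' → after Q u v ≼ after Q' u v
  after-mono u v Q≼Q' z with cell? z u
  ... | yes _ = +-monoˡ-≤ _ (∸-monoˡ-≤ k (Q≼Q' z))
  ... | no  _ = +-monoˡ-≤ _ (Q≼Q' z)

  -- `does (adjacent? x z)` unfolds, so `with` cannot abstract over it; case
  -- splits therefore go through `toSum` and these equations for fire and after.
  fire-centre : ∀ (Q : Distribution m n) x → fire k Q x x ≡ Q x ∸ k
  fire-centre Q x = if-yes (cell? x x) refl

  fire-adjacent : ∀ (Q : Distribution m n) {x z} → Adjacent x z → fire k Q x z ≡ suc (Q z)
  fire-adjacent Q {x} {z} x~z =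
    trans (if-no (cell? z x) (adjacent⇒≢ x~z)) (if-yes (adjacent? x z) x~z)

  fire-far : ∀ (Q : Distribution m n) {x z} → ¬ z ≡ x → ¬ Adjacent x z → fire k Q x z ≡ Q z
  fire-far Q {x} {z} z≢x x≁z = trans (if-no (cell? z x) z≢x) (if-no (adjacent? x z) x≁z)

  fire-off-centre : ∀ (Q : Distribution m n) {x z} → ¬ z ≡ x → Q z ≤ fire k Q x z
  fire-off-centre Q {x} {z} z≢x with toSum (adjacent? x z)
  ... | inj₁ x~z = ≤-trans (n≤1+n (Q z)) (≤-reflexive (sym (fire-adjacent Q x~z)))
  ... | inj₂ x≁z = ≤-reflexive (sym (fire-far Q z≢x x≁z))

  after-centre≼fire : ∀ (Q : Distribution m n) {x v} → Adjacent x v → after Q x v ≼ fire k Q x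
  after-centre≼fire Q {x} {v} x~v z with toSum (cell? z x) | toSum (cell? z v)
  ... | inj₁ refl | _ = begin
    after Q x v x       ≡⟨ after-source Q x v ⟩
    Q x ∸ k + gain v x  ≡⟨ cong (Q x ∸ k +_) (gain-other (λ x≡v → adjacent⇒≢ x~v (sym x≡v))) ⟩
    Q x ∸ k + 0         ≡⟨ +-identityʳ (Q x ∸ k) ⟩
    Q x ∸ k             ≡⟨ fire-centre Q x ⟨
    fire k Q x x        ∎
    where open ≤-Reasoning
  ... | inj₂ z≢x | inj₁ refl = begin
    after Q x v v       ≡⟨ after-other Q v z≢x ⟩
    Q v + gain v v      ≡⟨ cong (Q v +_) (gain-target v) ⟩
    Q v + 1             ≡⟨ +-comm (Q v) 1 ⟩
    suc (Q v)           ≡⟨ fire-adjacent Q x~v ⟨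
    fire k Q x v        ∎
    where open ≤-Reasoning
  ... | inj₂ z≢x | inj₂ z≢v = begin
    after Q x v z       ≡⟨ after-other Q v z≢x ⟩
    Q z + gain v z      ≡⟨ cong (Q z +_) (gain-other z≢v) ⟩
    Q z + 0             ≡⟨ +-identityʳ (Q z) ⟩
    Q z                 ≤⟨ fire-off-centre Q z≢x ⟩
    fire k Q x z        ∎
    where open ≤-Reasoning

  after-cong-at : ∀ {Q Q' : Distribution m n} u v {z} → Q z ≡ Q' z → after Q u v z ≡ after Q' u v z
  after-cong-at u v {z} eq with cell? z u
  ... | yes _ = cong (λ a → a ∸ k + gain v z) eq
  ... | no  _ = cong (_+ gain v z) eq

  fire-after≼after-fire-centre : ∀ (Q : Distribution m n) {x u} v → ¬ x ≡ u →
    fire k (after Q u v) x x ≤ after (fire k Q x) u v x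
  fire-after≼after-fire-centre Q {x} {u} v x≢u = begin
    fire k (after Q u v) x x    ≡⟨ fire-centre (after Q u v) x ⟩
    after Q u v x ∸ k           ≡⟨ cong (_∸ k) (after-other Q v x≢u) ⟩
    Q x + gain v x ∸ k          ≤⟨ m+n∸o≤m∸o+n (Q x) (gain v x) k ⟩
    Q x ∸ k + gain v x          ≡⟨ cong (_+ gain v x) (fire-centre Q x) ⟨
    fire k Q x x + gain v x     ≡⟨ after-other (fire k Q x) v x≢u ⟨
    after (fire k Q x) u v x    ∎
    where open ≤-Reasoning

  fire-after≡after-fire-off-centre : ∀ (Q : Distribution m n) {x u} v {z} → k ≤ Q u → ¬ z ≡ x →
    fire k (after Q u v) x z ≡ after (fire k Q x) u v z
  fire-after≡after-fire-off-centre Q {x} {u} v {z} k≤Qu z≢x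
    with toSum (adjacent? x z) | toSum (cell? z u)
  ... | inj₂ x≁z | _ =
    trans (fire-far (after Q u v) z≢x x≁z)
          (after-cong-at {Q} {fire k Q x} u v (sym (fire-far Q z≢x x≁z)))
  ... | inj₁ x~u | inj₁ refl = begin
    fire k (after Q u v) x u     ≡⟨ fire-adjacent (after Q u v) x~u ⟩
    suc (after Q u v u)          ≡⟨ cong suc (after-source Q u v) ⟩
    suc (Q u ∸ k + gain v u)     ≡⟨ cong (_+ gain v u) (+-∸-assoc 1 k≤Qu) ⟨
    suc (Q u) ∸ k + gain v u     ≡⟨ cong (λ a → a ∸ k + gain v u) (fire-adjacent Q x~u) ⟨
    fire k Q x u ∸ k + gain v u  ≡⟨ after-source (fire k Q x) u v ⟨
    after (fire k Q x) u v u     ∎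
    where open ≡-Reasoning
  ... | inj₁ x~z | inj₂ z≢u = begin
    fire k (after Q u v) x z     ≡⟨ fire-adjacent (after Q u v) x~z ⟩
    suc (after Q u v z)          ≡⟨ cong suc (after-other Q v z≢u) ⟩
    suc (Q z) + gain v z         ≡⟨ cong (_+ gain v z) (fire-adjacent Q x~z) ⟨
    fire k Q x z + gain v z      ≡⟨ after-other (fire k Q x) v z≢u ⟨
    after (fire k Q x) u v z     ∎
    where open ≡-Reasoning

  fire-after≼after-fire : ∀ (Q : Distribution m n) {x u} v → ¬ u ≡ x → k ≤ Q u →
    fire k (after Q u v) x ≼ after (fire k Q x) u v
  fire-after≼after-fire Q {x} v u≢x k≤Qu z with toSum (cell? z x)
  ... | inj₁ refl = fire-after≼after-fire-centre Q v (λ x≡u → u≢x (sym x≡u))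
  ... | inj₂ z≢x  = ≤-reflexive (fire-after≡after-fire-off-centre Q v k≤Qu z≢x)

  reaches-mono : ∀ {Q Qh R} → Q ≼ Qh → Reaches k Q R → ∃ λ Rh → Reaches k Qh Rh × R ≼ Rh
  reaches-mono Q≼Qh done = _ , done , Q≼Qh
  reaches-mono Q≼Qh (step (move u v u~v k≤Qu) Q⇝R) with reaches-mono (after-mono u v Q≼Qh) Q⇝R
  ... | Rh , Qh⇝Rh , R≼Rh = Rh , step (move u v u~v (≤-trans k≤Qu (Q≼Qh u))) Qh⇝Rh , R≼Rh

  reaches-fire-mono : ∀ {Q Qh R} x → fire k Q x ≼ Qh → Reaches k Q R →
    ∃ λ Rh → Reaches k Qh Rh × (∀ z → ¬ z ≡ x → R z ≤ Rh z)
  reaches-fire-mono {Q} x fire≼Qh done =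
    _ , done , λ z z≢x → ≤-trans (fire-off-centre Q z≢x) (fire≼Qh z)
  reaches-fire-mono {Q} x fire≼Qh (step (move u v u~v k≤Qu) Q⇝R) with toSum (cell? u x)
  ... | inj₁ refl with reaches-mono (≼-trans (after-centre≼fire Q u~v) fire≼Qh) Q⇝R
  ...   | Rh , Qh⇝Rh , R≼Rh = Rh , Qh⇝Rh , λ z _ → R≼Rh z
  reaches-fire-mono {Q} {Qh} x fire≼Qh (step (move u v u~v k≤Qu) Q⇝R) | inj₂ u≢x
    with reaches-fire-mono x
           (≼-trans (fire-after≼after-fire Q v u≢x k≤Qu) (after-mono u v fire≼Qh)) Q⇝R
  ... | Rh , Qh⇝Rh , R≤Rh = Rh , step (move u v u~v k≤Qhu) Qh⇝Rh , R≤Rh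
    where
    k≤Qhu : k ≤ Qh u
    k≤Qhu = ≤-trans k≤Qu (≤-trans (fire-off-centre Q u≢x) (fire≼Qh u))

mainTheorem3 : (k m n : ℕ) → 1 ≤ m → 1 ≤ n → (P : Distribution m n) →
    Solvable k P → (x : Cell m n) → P x ≥ k + 1 → Solvable k (fire k P x)
mainTheorem3 k m n _ _ P solvable x Px≥k+1 y with toSum (cell? y x)
... | inj₁ refl = fire k P x , done ,
  subst (1 ≤_) (sym (fire-centre k P x))
        (m+n≤o⇒m≤o∸n 1 (≤-trans (≤-reflexive (+-comm 1 k)) Px≥k+1))
... | inj₂ y≢x with solvable y
...   | Q , P⇝Q , 1≤Qy with reaches-fire-mono k x (λ _ → ≤-refl) P⇝Q
...     | R , P̂⇝R , Q≤R = R , P̂⇝R , ≤-trans 1≤Qy (Q≤R y y≢x)
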